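{- Let $a,m$ be positive integers such that $N=5^{2a}m^2$ is a friend of $10$. Then $\Omega(N)\ge 2\,\omega(N)+6a-4$.
   Context: For a positive integer $n$, $\sigma(n)$ denotes the sum of the positive divisors of $n$ and $I(n)=\sigma(n)/n$. A positive integer $N>10$ is called a friend of $10$ if $I(N)=9/5$. $\Omega(n)$ denotes the total number of prime factors of $n$ counted with multiplicity, and $\omega(n)$ the number of distinct prime factors of $n$. -}

module Defs where

open import Data.Nat using (ℕ; zero; suc; _+_; _*_; _^_)
open import Data.Nat.Divisibility using (_∣?_)
open import Data.Nat.Primality using (prime?)
open import Data.List using (List; map; filter; length)
open import Data.Nat.ListAction using (sum)
open import Data.Nat using (_<_)
open import Data.Product using (_×_)
open import Relation.Binary.PropositionalEquality using (_≡_)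
open import Data.List.Base using (upTo)

range1 : ℕ → List ℕ
range1 n = map suc (upTo n)

-- divisors of n (for n ≥ 1): all d ∈ [1..n] with d ∣ n
divisors : ℕ → List ℕ
divisors n = filter (λ d → d ∣? n) (range1 n)

σ : ℕ → ℕ
σ n = sum (divisors n)

primeDivisors : ℕ → List ℕ
primeDivisors n = filter prime? (divisors n)

ω : ℕ → ℕ
ω n = length (primeDivisors n)

-- p-adic valuation v_p(n) for n ≥ 1, p ≥ 2: number of k ∈ [1..n] with p^k ∣ n
val : ℕ → ℕ → ℕ
val p n = length (filter (λ k → (p ^ k) ∣? n) (range1 n))

Ω : ℕ → ℕ
Ω n = sum (map (λ p → val p n) (primeDivisors n))

-- N is a friend of 10: N > 10 and I(N) = σ(N)/N = 9/5, i.e. 5·σ(N) = 9·N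
FriendOf10 : ℕ → Set
FriendOf10 N = (10 < N) × (5 * σ N ≡ 9 * N)

-- Write N = 5^e u² with 5 ∤ u and e = 2a + 2 v₅(m). Since σ(5^e) ≡ 1 (mod 5), the equation
-- 5 σ(N) = 9 N leaves 5^(e-1) ∣ σ(u²). For each prime power p^(2f) ∥ u², the factor
-- σ(p^(2f)) = 1 + p + ⋯ + p^(2f) has odd length, so it is prime to 5 unless p ≡ 1 (mod 5), and then,
-- by lifting the exponent, its 5-adic valuation is v₅(2f + 1) < f. Adding up over the primes of u
-- gives Ω(u²) ≥ 2 ω(u²) + 2 (e - 1), and putting the prime 5 back yields
-- Ω(N) ≥ 2 ω(N) + 3e - 4 ≥ 2 ω(N) + 6a - 4.

module Submission where

open import Defs
open import Data.Bool using (true; false; if_then_else_)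
open import Data.List using ([]; _∷_; [_]; _++_; map; filter; length; upTo)
open import Data.List.Properties using (upTo-∷ʳ; map-++; map-id)
open import Data.List.Relation.Unary.All using (_∷_)
open import Data.Nat using (ℕ; zero; suc; _+_; _∸_; _*_; _^_; _≤_; _<_; z≤n; s≤s; z<s; _≟_; _%_; _/_; NonZero; >-nonZero; >-nonZero⁻¹; nonTrivial⇒n>1)
open import Data.Nat.Coprimality using (Coprime; coprime-divisor)
open import Data.Nat.DivMod using (m≡m%n+[m/n]*n; m%n<n)
open import Data.Nat.Divisibility
open import Data.Nat.Induction using (<-wellFounded)
open import Data.Nat.ListAction using (sum; product)
open import Data.Nat.ListAction.Properties using (sum-++)
open import Data.Nat.Primality using (Prime; prime?; euclidsLemma; prime⇒irreducible; prime⇒nonZero; prime⇒nonTrivial; ¬prime[1])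
open import Data.Nat.Primality.Factorisation using (factorise)
open import Data.Nat.Properties
open import Algebra.Properties.CommutativeSemigroup +-commutativeSemigroup using () renaming (interchange to +-interchange)
open import Algebra.Properties.CommutativeSemigroup *-commutativeSemigroup using (x∙yz≈y∙xz; xy∙z≈y∙xz; x∙yz≈z∙xy) renaming (interchange to *-interchange)
open import Data.Nat.Tactic.RingSolver using (solve-∀)
open import Data.Product using (_×_; _,_; proj₁; proj₂; ∃-syntax)
open import Data.Sum using (inj₁; inj₂)
open import Function using (id; _∘_)
open import Induction.WellFounded using (Acc; acc)
open import Relation.Binary.PropositionalEquality hiding ([_])
open import Relation.Nullary using (Dec; does; yes; no; ¬_; contradiction)
open import Relation.Nullary.Decidable using (True; False; from-yes; toWitness; toWitnessFalse; dec-true; dec-false)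
open import Relation.Unary using (Pred; Decidable)

-- Sums of indicators over [1 .. n]

when : ∀ {p} {P : Set p} → Dec P → ℕ → ℕ
when P? x = if does P? then x else 0

module _ {p} {P : Set p} (P? : Dec P) (x : ℕ) where

  when-yes : P → when P? x ≡ x
  when-yes holds rewrite dec-true P? holds = refl

  when-no : ¬ P → when P? x ≡ 0
  when-no fails rewrite dec-false P? fails = refl

module _ {a p} {A : Set a} {P : Pred A p} (P? : Decidable P) where

  sum-map-filter : ∀ (f : A → ℕ) xs → sum (map f (filter P? xs)) ≡ sum (map (λ x → when (P? x) (f x)) xs)
  sum-map-filter f [] = refl
  sum-map-filter f (x ∷ xs) with does (P? x)
  ... | true  = cong (f x +_) (sum-map-filter f xs)
  ... | false = sum-map-filter f xs

  length-filter≡count : ∀ xs → length (filter P? xs) ≡ sum (map (λ x → when (P? x) 1) xs)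
  length-filter≡count [] = refl
  length-filter≡count (x ∷ xs) with does (P? x)
  ... | true  = cong suc (length-filter≡count xs)
  ... | false = length-filter≡count xs

module _ {a} {A : Set a} where

  sum-map-+ : ∀ (f g : A → ℕ) xs → sum (map (λ x → f x + g x) xs) ≡ sum (map f xs) + sum (map g xs)
  sum-map-+ f g [] = refl
  sum-map-+ f g (x ∷ xs) = begin
    f x + g x + sum (map (λ x → f x + g x) xs)   ≡⟨ cong (f x + g x +_) (sum-map-+ f g xs) ⟩
    f x + g x + (sum (map f xs) + sum (map g xs)) ≡⟨ +-interchange (f x) (g x) _ _ ⟩
    f x + sum (map f xs) + (g x + sum (map g xs)) ∎
    where open ≡-Reasoning

  sum-map-* : ∀ c (f : A → ℕ) xs → sum (map (λ x → c * f x) xs) ≡ c * sum (map f xs)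
  sum-map-* c f [] = sym (*-zeroʳ c)
  sum-map-* c f (x ∷ xs) = trans (cong (c * f x +_) (sum-map-* c f xs)) (sym (*-distribˡ-+ c (f x) _))

sumTo : ℕ → (ℕ → ℕ) → ℕ
sumTo n f = sum (map f (range1 n))

sumTo-suc : ∀ n f → sumTo (suc n) f ≡ sumTo n f + f (suc n)
sumTo-suc n f = begin
  sum (map f (map suc (upTo (suc n))))          ≡⟨ cong (λ xs → sum (map f (map suc xs))) (upTo-∷ʳ n) ⟨
  sum (map f (map suc (upTo n ++ [ n ])))       ≡⟨ cong (λ xs → sum (map f xs)) (map-++ suc (upTo n) [ n ]) ⟩
  sum (map f (range1 n ++ [ suc n ]))           ≡⟨ cong sum (map-++ f (range1 n) [ suc n ]) ⟩
  sum (map f (range1 n) ++ [ f (suc n) ])       ≡⟨ sum-++ (map f (range1 n)) [ f (suc n) ] ⟩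
  sumTo n f + (f (suc n) + 0)                   ≡⟨ cong (sumTo n f +_) (+-identityʳ (f (suc n))) ⟩
  sumTo n f + f (suc n)                         ∎
  where open ≡-Reasoning

sumTo-cong : ∀ n {f g} → (∀ d → 0 < d → d ≤ n → f d ≡ g d) → sumTo n f ≡ sumTo n g
sumTo-cong zero    f≗g = refl
sumTo-cong (suc n) {f} {g} f≗g = begin
  sumTo (suc n) f       ≡⟨ sumTo-suc n f ⟩
  sumTo n f + f (suc n) ≡⟨ cong₂ _+_ (sumTo-cong n (λ d 0<d d≤n → f≗g d 0<d (m≤n⇒m≤1+n d≤n))) (f≗g (suc n) z<s ≤-refl) ⟩
  sumTo n g + g (suc n) ≡⟨ sumTo-suc n g ⟨
  sumTo (suc n) g       ∎
  where open ≡-Reasoning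

sumTo-mono : ∀ n {f g} → (∀ d → 0 < d → d ≤ n → f d ≤ g d) → sumTo n f ≤ sumTo n g
sumTo-mono zero    f≤g = z≤n
sumTo-mono (suc n) {f} {g} f≤g = begin
  sumTo (suc n) f       ≡⟨ sumTo-suc n f ⟩
  sumTo n f + f (suc n) ≤⟨ +-mono-≤ (sumTo-mono n (λ d 0<d d≤n → f≤g d 0<d (m≤n⇒m≤1+n d≤n))) (f≤g (suc n) z<s ≤-refl) ⟩
  sumTo n g + g (suc n) ≡⟨ sumTo-suc n g ⟨
  sumTo (suc n) g       ∎
  where open ≤-Reasoning

sumTo-const : ∀ n c → sumTo n (λ _ → c) ≡ n * c
sumTo-const zero    c = refl
sumTo-const (suc n) c = trans (sumTo-suc n (λ _ → c)) (trans (cong (_+ c) (sumTo-const n c)) (+-comm (n * c) c))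

sumTo-+ : ∀ m n f → sumTo (m + n) f ≡ sumTo m f + sumTo n (λ i → f (m + i))
sumTo-+ m zero    f = trans (cong (λ k → sumTo k f) (+-identityʳ m)) (sym (+-identityʳ (sumTo m f)))
sumTo-+ m (suc n) f = begin
  sumTo (m + suc n) f                                    ≡⟨ cong (λ k → sumTo k f) (+-suc m n) ⟩
  sumTo (suc (m + n)) f                                  ≡⟨ sumTo-suc (m + n) f ⟩
  sumTo (m + n) f + f (suc (m + n))                      ≡⟨ cong₂ _+_ (sumTo-+ m n f) (cong f (sym (+-suc m n))) ⟩
  sumTo m f + sumTo n (λ i → f (m + i)) + f (m + suc n)  ≡⟨ +-assoc (sumTo m f) _ _ ⟩
  sumTo m f + (sumTo n (λ i → f (m + i)) + f (m + suc n)) ≡⟨ cong (sumTo m f +_) (sumTo-suc n (λ i → f (m + i))) ⟨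
  sumTo m f + sumTo (suc n) (λ i → f (m + i))            ∎
  where open ≡-Reasoning

sumTo-prefix : ∀ {m} n f → m ≤ n → sumTo m f ≤ sumTo n f
sumTo-prefix zero    f z≤n = ≤-refl
sumTo-prefix (suc n) f m≤1+n with m≤n⇒m<n∨m≡n m≤1+n
... | inj₂ refl      = ≤-refl
... | inj₁ (s≤s m≤n) = ≤-trans (sumTo-prefix n f m≤n) (≤-trans (m≤m+n (sumTo n f) (f (suc n))) (≤-reflexive (sym (sumTo-suc n f))))

sumTo-vanishing-tail : ∀ {m} n f → m ≤ n → (∀ d → m < d → d ≤ n → f d ≡ 0) → sumTo n f ≡ sumTo m f
sumTo-vanishing-tail zero    f z≤n vanish = refl
sumTo-vanishing-tail {m} (suc n) f m≤1+n vanish with m≤n⇒m<n∨m≡n m≤1+n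
... | inj₂ refl      = refl
... | inj₁ (s≤s m≤n) = begin
  sumTo (suc n) f       ≡⟨ sumTo-suc n f ⟩
  sumTo n f + f (suc n) ≡⟨ cong₂ _+_ (sumTo-vanishing-tail n f m≤n (λ d m<d d≤n → vanish d m<d (m≤n⇒m≤1+n d≤n)))
                                     (vanish (suc n) (s≤s m≤n) ≤-refl) ⟩
  sumTo m f + 0         ≡⟨ +-identityʳ (sumTo m f) ⟩
  sumTo m f             ∎
  where open ≡-Reasoning

sumTo-single : ∀ {p} n f → 0 < p → p ≤ n → (∀ d → 0 < d → d ≤ n → d ≢ p → f d ≡ 0) → sumTo n f ≡ f p
sumTo-single {p@(suc q)} n f _ p≤n vanish = begin
  sumTo n f               ≡⟨ sumTo-vanishing-tail n f p≤n (λ d p<d d≤n → vanish d (<-trans z<s p<d) d≤n (>⇒≢ p<d)) ⟩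
  sumTo p f               ≡⟨ sumTo-suc q f ⟩
  sumTo q f + f p         ≡⟨ cong (_+ f p) (sumTo-cong q (λ d 0<d d≤q → vanish d 0<d (≤-trans (m≤n⇒m≤1+n d≤q) p≤n) (<⇒≢ (s≤s d≤q)))) ⟩
  sumTo q (λ _ → 0) + f p ≡⟨ cong (_+ f p) (trans (sumTo-const q 0) (*-zeroʳ q)) ⟩
  f p                     ∎
  where open ≡-Reasoning

sumTo-multiples : ∀ {p} n f → 0 < p → (∀ d → ¬ p ∣ d → f d ≡ 0) → sumTo (p * n) f ≡ sumTo n (λ d → f (p * d))
sumTo-multiples {p} zero    f 0<p vanish = cong (λ k → sumTo k f) (*-zeroʳ p)
sumTo-multiples {p} (suc n) f 0<p vanish = begin
  sumTo (p * suc n) f                             ≡⟨ cong (λ k → sumTo k f) p*[1+n]≡p*n+p ⟩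
  sumTo (p * n + p) f                             ≡⟨ sumTo-+ (p * n) p f ⟩
  sumTo (p * n) f + sumTo p (λ i → f (p * n + i)) ≡⟨ cong₂ _+_ (sumTo-multiples n f 0<p vanish) last-block ⟩
  sumTo n (λ d → f (p * d)) + f (p * n + p)       ≡⟨ cong (λ k → sumTo n (λ d → f (p * d)) + f k) p*[1+n]≡p*n+p ⟨
  sumTo n (λ d → f (p * d)) + f (p * suc n)       ≡⟨ sumTo-suc n (λ d → f (p * d)) ⟨
  sumTo (suc n) (λ d → f (p * d))                 ∎
  where
  open ≡-Reasoning
  p*[1+n]≡p*n+p : p * suc n ≡ p * n + p
  p*[1+n]≡p*n+p = trans (*-suc p n) (+-comm p (p * n))
  p∤p*n+i : ∀ {i} → 0 < i → i < p → ¬ p ∣ p * n + i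
  p∤p*n+i 0<i i<p p∣ = <⇒≱ i<p (∣⇒≤ {{>-nonZero 0<i}} (∣m+n∣m⇒∣n p∣ (m∣m*n n)))
  last-block : sumTo p (λ i → f (p * n + i)) ≡ f (p * n + p)
  last-block = sumTo-single p _ 0<p ≤-refl (λ i 0<i i≤p i≢p → vanish (p * n + i) (p∤p*n+i 0<i (≤∧≢⇒< i≤p i≢p)))

-- σ, ω and Ω at a prime power

σ≡sumTo : ∀ n → σ n ≡ sumTo n (λ d → when (d ∣? n) d)
σ≡sumTo n = trans (cong sum (sym (map-id (divisors n)))) (sum-map-filter (_∣? n) id (range1 n))

ω≡sumTo : ∀ n → ω n ≡ sumTo n (λ d → when (d ∣? n) (when (prime? d) 1))
ω≡sumTo n = trans (length-filter≡count prime? (divisors n)) (sum-map-filter (_∣? n) _ (range1 n))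

Ω≡sumTo : ∀ n → Ω n ≡ sumTo n (λ d → when (d ∣? n) (when (prime? d) (val d n)))
Ω≡sumTo n = trans (sum-map-filter prime? (λ p → val p n) (divisors n)) (sum-map-filter (_∣? n) _ (range1 n))

val≡sumTo : ∀ p n → val p n ≡ sumTo n (λ k → when (p ^ k ∣? n) 1)
val≡sumTo p n = length-filter≡count (λ k → p ^ k ∣? n) (range1 n)

when-∣?-vanishes : ∀ {n d} x → 0 < n → n < d → when (d ∣? n) x ≡ 0
when-∣?-vanishes {n} {d} x 0<n n<d = when-no (d ∣? n) x (λ d∣n → <⇒≱ n<d (∣⇒≤ {{>-nonZero 0<n}} d∣n))

when-∣?-scale : ∀ p d n .{{_ : NonZero p}} → when (p * d ∣? p * n) (p * d) ≡ p * when (d ∣? n) d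
when-∣?-scale p d n with p * d ∣? p * n | d ∣? n
... | yes _      | yes _   = refl
... | yes pd∣pn  | no d∤n  = contradiction (*-cancelˡ-∣ p pd∣pn) d∤n
... | no pd∤pn   | yes d∣n = contradiction (*-monoʳ-∣ p d∣n) pd∤pn
... | no _       | no _    = sym (*-zeroʳ p)

0<p^e*t : ∀ {p} e {t} → Prime p → 0 < t → 0 < p ^ e * t
0<p^e*t {p} e {t} pr 0<t = >-nonZero⁻¹ (p ^ e * t)
  where
  instance
    _ = prime⇒nonZero pr
    _ = >-nonZero 0<t
    _ = m^n≢0 p e
    _ = m*n≢0 (p ^ e) t

¬∣⇒coprime : ∀ {p d} → Prime p → ¬ p ∣ d → Coprime d p
¬∣⇒coprime pr p∤d (i∣d , i∣p) with prime⇒irreducible pr i∣p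
... | inj₁ i≡1  = i≡1
... | inj₂ refl = contradiction i∣d p∤d

∣p^e*t⇒∣t : ∀ {p d t} e → Prime p → ¬ p ∣ d → d ∣ p ^ e * t → d ∣ t
∣p^e*t⇒∣t {d = d} {t} zero    pr p∤d d∣t = subst (d ∣_) (*-identityˡ t) d∣t
∣p^e*t⇒∣t {p} {d} {t} (suc e) pr p∤d d∣p*p^e*t =
  ∣p^e*t⇒∣t e pr p∤d (coprime-divisor (¬∣⇒coprime pr p∤d) (subst (d ∣_) (*-assoc p (p ^ e) t) d∣p*p^e*t))

∤⇒0< : ∀ {p u} → ¬ p ∣ u → 0 < u
∤⇒0< {u = zero}  p∤0 = contradiction (_ ∣0) p∤0
∤⇒0< {u = suc u} _   = z<s

-- The divisors of p ^ (e + 1) * t divisible by p are p times those of p ^ e * t; the others are those of t.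
σ[p*p^e*t] : ∀ {p t} e → Prime p → ¬ p ∣ t → σ (p * (p ^ e * t)) ≡ σ t + p * σ (p ^ e * t)
σ[p*p^e*t] {p} {t} e pr p∤t = begin
  σ (p * M)                                               ≡⟨ σ≡sumTo (p * M) ⟩
  sumTo (p * M) (λ d → when (d ∣? p * M) d)               ≡⟨ sumTo-cong (p * M) (λ d _ _ → split d) ⟩
  sumTo (p * M) (λ d → multiple d + when (d ∣? t) d)      ≡⟨ sum-map-+ multiple (λ d → when (d ∣? t) d) (range1 (p * M)) ⟩
  sumTo (p * M) multiple + sumTo (p * M) (λ d → when (d ∣? t) d)
    ≡⟨ cong₂ _+_ (sumTo-multiples M multiple 0<p (λ d → when-no (p ∣? d) _))
                 (sumTo-vanishing-tail (p * M) _ t≤p*M (λ d t<d _ → when-∣?-vanishes d 0<t t<d)) ⟩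
  sumTo M (λ d → multiple (p * d)) + sumTo t (λ d → when (d ∣? t) d)
    ≡⟨ cong₂ _+_ (sumTo-cong M (λ d _ _ → multiple-scale d)) (sym (σ≡sumTo t)) ⟩
  sumTo M (λ d → p * when (d ∣? M) d) + σ t               ≡⟨ cong (_+ σ t) (sum-map-* p _ (range1 M)) ⟩
  p * sumTo M (λ d → when (d ∣? M) d) + σ t               ≡⟨ cong (λ s → p * s + σ t) (σ≡sumTo M) ⟨
  p * σ M + σ t                                           ≡⟨ +-comm (p * σ M) (σ t) ⟩
  σ t + p * σ M                                           ∎
  where
  open ≡-Reasoning
  M = p ^ e * t
  0<t : 0 < t
  0<t = ∤⇒0< p∤t
  instance
    _ = prime⇒nonZero pr
    _ = >-nonZero (0<p^e*t e pr 0<t)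
  0<p : 0 < p
  0<p = >-nonZero⁻¹ p
  t≤p*M : t ≤ p * M
  t≤p*M = ∣⇒≤ {{m*n≢0 p M}} (∣-trans (n∣m*n (p ^ e)) (n∣m*n p))
  multiple : ℕ → ℕ
  multiple d = when (p ∣? d) (when (d ∣? p * M) d)
  multiple-scale : ∀ d → multiple (p * d) ≡ p * when (d ∣? M) d
  multiple-scale d = trans (when-yes (p ∣? p * d) _ (m∣m*n d)) (when-∣?-scale p d M)
  split : ∀ d → when (d ∣? p * M) d ≡ multiple d + when (d ∣? t) d
  split d with p ∣? d | d ∣? p * M | d ∣? t
  ... | yes p∣d | _         | yes d∣t  = contradiction (∣-trans p∣d d∣t) p∤t
  ... | yes _   | _         | no _     = sym (+-identityʳ _)
  ... | no _    | yes _     | yes _    = refl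
  ... | no _    | no d∤pM   | yes d∣t  = contradiction (∣-trans d∣t (∣-trans (n∣m*n (p ^ e)) (n∣m*n p))) d∤pM
  ... | no p∤d  | yes d∣pM  | no d∤t   = contradiction (∣p^e*t⇒∣t (suc e) pr p∤d (subst (d ∣_) (sym (*-assoc p (p ^ e) t)) d∣pM)) d∤t
  ... | no _    | no _      | no _     = refl

geomSum : ℕ → ℕ → ℕ
geomSum p zero    = 0
geomSum p (suc n) = 1 + p * geomSum p n

σ[p^e*t] : ∀ {p t} e → Prime p → ¬ p ∣ t → σ (p ^ e * t) ≡ geomSum p (suc e) * σ t
σ[p^e*t] {p} {t} zero    pr p∤t = begin
  σ (1 * t)               ≡⟨ cong σ (*-identityˡ t) ⟩
  σ t                     ≡⟨ *-identityˡ (σ t) ⟨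
  1 * σ t                 ≡⟨ cong (λ x → (1 + x) * σ t) (*-zeroʳ p) ⟨
  geomSum p 1 * σ t       ∎
  where open ≡-Reasoning
σ[p^e*t] {p} {t} (suc e) pr p∤t = begin
  σ (p * p ^ e * t)                          ≡⟨ cong σ (*-assoc p (p ^ e) t) ⟩
  σ (p * (p ^ e * t))                        ≡⟨ σ[p*p^e*t] e pr p∤t ⟩
  σ t + p * σ (p ^ e * t)                    ≡⟨ cong (λ x → σ t + p * x) (σ[p^e*t] e pr p∤t) ⟩
  σ t + p * (geomSum p (suc e) * σ t)        ≡⟨ horner p (geomSum p (suc e)) (σ t) ⟩
  (1 + p * geomSum p (suc e)) * σ t          ∎
  where
  open ≡-Reasoning
  horner : ∀ p g s → s + p * (g * s) ≡ (1 + p * g) * s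
  horner = solve-∀

n<m^n : ∀ {m} n → 1 < m → n < m ^ n
n<m^n zero    _   = s≤s z≤n
n<m^n {m} (suc n) 1<m = begin-strict
  suc n     ≤⟨ n<m^n n 1<m ⟩
  m ^ n     <⟨ m<m*n (m ^ n) m 1<m ⟩
  m ^ n * m ≡⟨ *-comm (m ^ n) m ⟩
  m * m ^ n ∎
  where
  open ≤-Reasoning
  instance _ = m^n≢0 m n {{>-nonZero (<-trans z<s 1<m)}}

m^k∣m^e : ∀ m {k e} → k ≤ e → m ^ k ∣ m ^ e
m^k∣m^e m {k} {e} k≤e = subst (m ^ k ∣_) (trans (sym (^-distribˡ-+-* m k (e ∸ k))) (cong (m ^_) (m+[n∸m]≡n k≤e))) (m∣m*n _)

p^e∣n⇒e≤val : ∀ {p n} e → 1 < p → 0 < n → p ^ e ∣ n → e ≤ val p n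
p^e∣n⇒e≤val {p} {n} e 1<p 0<n p^e∣n = begin
  e                                       ≡⟨ trans (sumTo-const e 1) (*-identityʳ e) ⟨
  sumTo e (λ _ → 1)                       ≡⟨ sumTo-cong e (λ k _ k≤e → sym (when-yes (p ^ k ∣? n) 1 (∣-trans (m^k∣m^e p k≤e) p^e∣n))) ⟩
  sumTo e (λ k → when (p ^ k ∣? n) 1)     ≤⟨ sumTo-prefix n _ e≤n ⟩
  sumTo n (λ k → when (p ^ k ∣? n) 1)     ≡⟨ val≡sumTo p n ⟨
  val p n                                 ∎
  where
  open ≤-Reasoning
  e≤n : e ≤ n
  e≤n = <⇒≤ (<-≤-trans (n<m^n e 1<p) (∣⇒≤ {{>-nonZero 0<n}} p^e∣n))

val-mono-∣ : ∀ p {m n} → 0 < n → m ∣ n → val p m ≤ val p n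
val-mono-∣ p {m} {n} 0<n m∣n = begin
  val p m                                 ≡⟨ val≡sumTo p m ⟩
  sumTo m (λ k → when (p ^ k ∣? m) 1)     ≤⟨ sumTo-prefix n _ (∣⇒≤ {{>-nonZero 0<n}} m∣n) ⟩
  sumTo n (λ k → when (p ^ k ∣? m) 1)     ≤⟨ sumTo-mono n (λ k _ _ → indicator-mono k) ⟩
  sumTo n (λ k → when (p ^ k ∣? n) 1)     ≡⟨ val≡sumTo p n ⟨
  val p n                                 ∎
  where
  open ≤-Reasoning
  indicator-mono : ∀ k → when (p ^ k ∣? m) 1 ≤ when (p ^ k ∣? n) 1
  indicator-mono k with p ^ k ∣? m | p ^ k ∣? n
  ... | no _      | _        = z≤n
  ... | yes _     | yes _    = ≤-refl
  ... | yes p^k∣m | no p^k∤n = contradiction (∣-trans p^k∣m m∣n) p^k∤n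

prime⇒1<p : ∀ {p} → Prime p → 1 < p
prime⇒1<p {p} pr = nonTrivial⇒n>1 p {{prime⇒nonTrivial pr}}

prime∣prime⇒≡ : ∀ {p q} → Prime p → Prime q → p ∣ q → p ≡ q
prime∣prime⇒≡ prp prq p∣q with prime⇒irreducible prq p∣q
... | inj₁ refl = contradiction prp ¬prime[1]
... | inj₂ p≡q  = p≡q

m∣m^e*t : ∀ m {e} t → 0 < e → m ∣ m ^ e * t
m∣m^e*t m {suc e} t _ = ∣-trans (m∣m*n (m ^ e)) (m∣m*n t)

ω[p^e*t]≤1+ω[t] : ∀ {p t} e → Prime p → 0 < t → 0 < e → ω (p ^ e * t) ≤ 1 + ω t
ω[p^e*t]≤1+ω[t] {p} {t} e pr 0<t 0<e = begin
  ω M                                                ≡⟨ ω≡sumTo M ⟩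
  sumTo M (primeDivisor M)                           ≤⟨ sumTo-mono M (λ d _ _ → split d) ⟩
  sumTo M (λ d → isP d + primeDivisor t d)           ≡⟨ sum-map-+ isP (primeDivisor t) (range1 M) ⟩
  sumTo M isP + sumTo M (primeDivisor t)
    ≡⟨ cong₂ _+_ (sumTo-single M isP (>-nonZero⁻¹ p) p≤M (λ d _ _ → when-no (d ≟ p) 1))
                 (sumTo-vanishing-tail M _ t≤M (λ d t<d _ → when-∣?-vanishes _ 0<t t<d)) ⟩
  isP p + sumTo t (primeDivisor t)                   ≡⟨ cong₂ _+_ (when-yes (p ≟ p) 1 refl) (sym (ω≡sumTo t)) ⟩
  1 + ω t                                            ∎
  where
  open ≤-Reasoning
  M = p ^ e * t
  instance
    _ = prime⇒nonZero pr
    _ = >-nonZero (0<p^e*t e pr 0<t)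
  t≤M : t ≤ M
  t≤M = ∣⇒≤ (n∣m*n (p ^ e))
  p≤M : p ≤ M
  p≤M = ∣⇒≤ (m∣m^e*t p t 0<e)
  primeDivisor : ℕ → ℕ → ℕ
  primeDivisor n d = when (d ∣? n) (when (prime? d) 1)
  isP : ℕ → ℕ
  isP d = when (d ≟ p) 1
  split : ∀ d → primeDivisor M d ≤ isP d + primeDivisor t d
  split d with d ∣? M | prime? d | p ∣? d | d ∣? t
  ... | no _    | _       | _       | _      = z≤n
  ... | yes _   | no _    | _       | _      = z≤n
  ... | yes _   | yes _   | _       | yes _  = m≤n+m 1 (isP d)
  ... | yes _   | yes prd | yes p∣d | no _   =
    ≤-reflexive (sym (trans (+-identityʳ (isP d)) (when-yes (d ≟ p) 1 (sym (prime∣prime⇒≡ pr prd p∣d)))))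
  ... | yes d∣M | yes _   | no p∤d  | no d∤t = contradiction (∣p^e*t⇒∣t e pr p∤d d∣M) d∤t

e+Ω[t]≤Ω[p^e*t] : ∀ {p t} e → Prime p → ¬ p ∣ t → 0 < e → e + Ω t ≤ Ω (p ^ e * t)
e+Ω[t]≤Ω[p^e*t] {p} {t} e pr p∤t 0<e = begin
  e + Ω t                                   ≤⟨ +-monoˡ-≤ (Ω t) (p^e∣n⇒e≤val e (prime⇒1<p pr) 0<M (m∣m*n t)) ⟩
  val p M + Ω t
    ≡⟨ cong₂ _+_ (trans (sumTo-single M atP (>-nonZero⁻¹ p) p≤M (λ d _ _ → when-no (d ≟ p) _)) (when-yes (p ≟ p) _ refl))
                 (trans (sumTo-vanishing-tail M _ t≤M (λ d t<d _ → when-∣?-vanishes _ 0<t t<d)) (sym (Ω≡sumTo t))) ⟨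
  sumTo M atP + sumTo M (primeVal t)        ≡⟨ sum-map-+ atP (primeVal t) (range1 M) ⟨
  sumTo M (λ d → atP d + primeVal t d)      ≤⟨ sumTo-mono M (λ d _ _ → merge d) ⟩
  sumTo M (primeVal M)                      ≡⟨ Ω≡sumTo M ⟨
  Ω M                                       ∎
  where
  open ≤-Reasoning
  M = p ^ e * t
  0<t : 0 < t
  0<t = ∤⇒0< p∤t
  0<M : 0 < M
  0<M = 0<p^e*t e pr 0<t
  instance
    _ = prime⇒nonZero pr
    _ = >-nonZero 0<M
  t≤M : t ≤ M
  t≤M = ∣⇒≤ (n∣m*n (p ^ e))
  p≤M : p ≤ M
  p≤M = ∣⇒≤ (m∣m^e*t p t 0<e)
  primeVal : ℕ → ℕ → ℕ
  primeVal n d = when (d ∣? n) (when (prime? d) (val d n))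
  atP : ℕ → ℕ
  atP d = when (d ≟ p) (val p M)
  primeVal-mono : ∀ d → primeVal t d ≤ primeVal M d
  primeVal-mono d with d ∣? t | d ∣? M | prime? d
  ... | no _    | _       | _     = z≤n
  ... | yes _   | _       | no _  = z≤n
  ... | yes _   | yes _   | yes _ = val-mono-∣ d 0<M (n∣m*n (p ^ e))
  ... | yes d∣t | no d∤M  | yes _ = contradiction (∣-trans d∣t (n∣m*n (p ^ e))) d∤M
  merge : ∀ d → atP d + primeVal t d ≤ primeVal M d
  merge d with d ≟ p
  ... | no d≢p = ≤-trans (≤-reflexive (cong (_+ primeVal t d) (when-no (d ≟ p) _ d≢p))) (primeVal-mono d)
  ... | yes refl = ≤-reflexive (begin-equality
    atP p + primeVal t p  ≡⟨ cong₂ _+_ (when-yes (p ≟ p) _ refl) (when-no (p ∣? t) _ p∤t) ⟩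
    val p M + 0           ≡⟨ +-identityʳ (val p M) ⟩
    val p M               ≡⟨ trans (when-yes (p ∣? M) _ (m∣m^e*t p t 0<e)) (when-yes (prime? p) _ pr) ⟨
    primeVal M p          ∎)

-- Powers of 5 dividing geometric sums

prime5 : Prime 5
prime5 = from-yes (prime? 5)

prime∤1 : ∀ {q} → Prime q → ¬ q ∣ 1
prime∤1 prq q∣1 = ¬prime[1] (subst Prime (∣1⇒≡1 q∣1) prq)

prime∤^ : ∀ {q r} k → Prime q → ¬ q ∣ r → ¬ q ∣ r ^ k
prime∤^ zero    prq q∤r = prime∤1 prq
prime∤^ {r = r} (suc k) prq q∤r q∣r*r^k with euclidsLemma r (r ^ k) prq q∣r*r^k
... | inj₁ q∣r   = q∤r q∣r
... | inj₂ q∣r^k = prime∤^ k prq q∤r q∣r^k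

prime^-∣-*-split : ∀ {q} j a b → Prime q → q ^ j ∣ a * b → ∃[ i ] ∃[ k ] (i + k ≡ j × q ^ i ∣ a × q ^ k ∣ b)
prime^-∣-*-split zero a b _ _ = 0 , 0 , refl , 1∣ a , 1∣ b
prime^-∣-*-split {q} (suc j) a b prq q^[1+j]∣ab with euclidsLemma a b prq (∣-trans (m∣m*n (q ^ j)) q^[1+j]∣ab)
... | inj₁ (divides a′ refl)
  with prime^-∣-*-split j a′ b prq (*-cancelˡ-∣ q {{prime⇒nonZero prq}} (subst (q ^ suc j ∣_) (xy∙z≈y∙xz a′ q b) q^[1+j]∣ab))
...   | i , k , refl , q^i∣a′ , q^k∣b = suc i , k , refl , subst (q ^ suc i ∣_) (*-comm q a′) (*-monoʳ-∣ q q^i∣a′) , q^k∣b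
prime^-∣-*-split {q} (suc j) a b prq q^[1+j]∣ab | inj₂ (divides b′ refl)
  with prime^-∣-*-split j a b′ prq (*-cancelˡ-∣ q {{prime⇒nonZero prq}} (subst (q ^ suc j ∣_) (x∙yz≈z∙xy a b′ q) q^[1+j]∣ab))
...   | i , k , refl , q^i∣a , q^k∣b′ = i , suc k , +-suc i k , q^i∣a , subst (q ^ suc k ∣_) (*-comm q b′) (*-monoʳ-∣ q q^k∣b′)

prime^∣a*b⇒prime^∣a : ∀ {q} j a b → Prime q → ¬ q ∣ b → q ^ j ∣ a * b → q ^ j ∣ a
prime^∣a*b⇒prime^∣a {q} j a b prq q∤b q^j∣ab with prime^-∣-*-split j a b prq q^j∣ab
... | i , zero  , i+0≡j , q^i∣a , _     = subst (λ e → q ^ e ∣ a) (trans (sym (+-identityʳ i)) i+0≡j) q^i∣a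
... | _ , suc k , _     , _     , q^k∣b = contradiction (∣-trans (m∣m*n (q ^ k)) q^k∣b) q∤b

geomSum-+ : ∀ p a b → geomSum p (a + b) ≡ geomSum p a + p ^ a * geomSum p b
geomSum-+ p zero    b = sym (+-identityʳ (geomSum p b))
geomSum-+ p (suc a) b = begin
  1 + p * geomSum p (a + b)                           ≡⟨ cong (λ x → 1 + p * x) (geomSum-+ p a b) ⟩
  1 + p * (geomSum p a + p ^ a * geomSum p b)         ≡⟨ distribute p (geomSum p a) (p ^ a) (geomSum p b) ⟩
  1 + p * geomSum p a + p * p ^ a * geomSum p b       ∎
  where
  open ≡-Reasoning
  distribute : ∀ p x y z → 1 + p * (x + y * z) ≡ 1 + p * x + p * y * z
  distribute = solve-∀

geomSum-* : ∀ p k n → geomSum p (k * n) ≡ geomSum p n * geomSum (p ^ n) k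
geomSum-* p zero    n = sym (*-zeroʳ (geomSum p n))
geomSum-* p (suc k) n = begin
  geomSum p (n + k * n)                               ≡⟨ geomSum-+ p n (k * n) ⟩
  geomSum p n + p ^ n * geomSum p (k * n)             ≡⟨ cong (λ x → geomSum p n + p ^ n * x) (geomSum-* p k n) ⟩
  geomSum p n + p ^ n * (geomSum p n * geomSum (p ^ n) k) ≡⟨ factor (geomSum p n) (p ^ n) (geomSum (p ^ n) k) ⟩
  geomSum p n * (1 + p ^ n * geomSum (p ^ n) k)       ∎
  where
  open ≡-Reasoning
  factor : ∀ x q y → x + q * (x * y) ≡ x * (1 + q * y)
  factor = solve-∀

geomSum[1,n] : ∀ n → geomSum 1 n ≡ n
geomSum[1,n] zero    = refl
geomSum[1,n] (suc n) = cong suc (trans (*-identityˡ (geomSum 1 n)) (geomSum[1,n] n))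

geomSum-mod : ∀ q r s n → ∃[ c ] geomSum (r + q * s) n ≡ geomSum r n + q * c
geomSum-mod q r s zero    = 0 , sym (*-zeroʳ q)
geomSum-mod q r s (suc n) with geomSum-mod q r s n
... | c , eq = s * geomSum r n + r * c + q * s * c , (begin
  1 + (r + q * s) * geomSum (r + q * s) n   ≡⟨ cong (λ x → 1 + (r + q * s) * x) eq ⟩
  1 + (r + q * s) * (geomSum r n + q * c)   ≡⟨ expand q r s (geomSum r n) c ⟩
  1 + r * geomSum r n + q * (s * geomSum r n + r * c + q * s * c) ∎)
  where
  open ≡-Reasoning
  expand : ∀ q r s g c → 1 + (r + q * s) * (g + q * c) ≡ 1 + r * g + q * (s * g + r * c + q * s * c)
  expand = solve-∀

^-mod : ∀ q r s n → ∃[ c ] (r + q * s) ^ n ≡ r ^ n + q * c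
^-mod q r s zero    = 0 , sym (cong suc (*-zeroʳ q))
^-mod q r s (suc n) with ^-mod q r s n
... | c , eq = s * r ^ n + r * c + q * s * c , (begin
  (r + q * s) * (r + q * s) ^ n   ≡⟨ cong ((r + q * s) *_) eq ⟩
  (r + q * s) * (r ^ n + q * c)   ≡⟨ expand q r s (r ^ n) c ⟩
  r * r ^ n + q * (s * r ^ n + r * c + q * s * c) ∎)
  where
  open ≡-Reasoning
  expand : ∀ q r s x c → (r + q * s) * (x + q * c) ≡ r * x + q * (s * x + r * c + q * s * c)
  expand = solve-∀

∣geomSum[r+q*s]⇒∣geomSum[r] : ∀ {q} r s n → q ∣ geomSum (r + q * s) n → q ∣ geomSum r n
∣geomSum[r+q*s]⇒∣geomSum[r] {q} r s n q∣S with geomSum-mod q r s n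
... | c , eq = ∣m+n∣m⇒∣n (subst (q ∣_) (trans eq (+-comm (geomSum r n) (q * c))) q∣S) (m∣m*n c)

geomSum[1+5w,5] : ∀ w → ∃[ x ] geomSum (1 + 5 * w) 5 ≡ 5 * (1 + 5 * x)
geomSum[1+5w,5] w = 25 * w * w * w * w + 25 * w * w * w + 10 * w * w + 2 * w , expand w
  where
  expand : ∀ w → let p = 1 + 5 * w in 1 + p * (1 + p * (1 + p * (1 + p * (1 + p * 0))))
                   ≡ 5 * (1 + 5 * (25 * w * w * w * w + 25 * w * w * w + 10 * w * w + 2 * w))
  expand = solve-∀

5∤1+5x : ∀ x → ¬ 5 ∣ 1 + 5 * x
5∤1+5x x 5∣1+5x = prime∤1 prime5 (∣m+n∣m⇒∣n (subst (5 ∣_) (+-comm 1 (5 * x)) 5∣1+5x) (m∣m*n x))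

geomSum[1+5s,n*5] : ∀ s n → ∃[ x ] geomSum (1 + 5 * s) (n * 5) ≡ 5 * (geomSum (1 + 5 * s) n * (1 + 5 * x))
geomSum[1+5s,n*5] s n = x , (begin
    geomSum p (n * 5)                        ≡⟨ cong (geomSum p) (*-comm n 5) ⟩
    geomSum p (5 * n)                        ≡⟨ geomSum-* p 5 n ⟩
    geomSum p n * geomSum (p ^ n) 5          ≡⟨ cong (λ r → geomSum p n * geomSum r 5) p^n≡1+5w ⟩
    geomSum p n * geomSum (1 + 5 * w) 5      ≡⟨ cong (geomSum p n *_) (proj₂ (geomSum[1+5w,5] w)) ⟩
    geomSum p n * (5 * (1 + 5 * x))          ≡⟨ x∙yz≈y∙xz (geomSum p n) 5 (1 + 5 * x) ⟩
    5 * (geomSum p n * (1 + 5 * x))          ∎)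
  where
  open ≡-Reasoning
  p = 1 + 5 * s
  w = proj₁ (^-mod 5 1 s n)
  x = proj₁ (geomSum[1+5w,5] w)
  p^n≡1+5w : p ^ n ≡ 1 + 5 * w
  p^n≡1+5w = trans (proj₂ (^-mod 5 1 s n)) (cong (_+ 5 * w) (^-zeroˡ n))

-- Lifting the exponent: geomSum p n ≡ n (mod 5), and replacing n by 5n multiplies geomSum p n
-- by exactly one factor 5.
5^j∣geomSum[1+5s,n]⇒5^j∣n : ∀ s j n → 5 ^ j ∣ geomSum (1 + 5 * s) n → 5 ^ j ∣ n
5^j∣geomSum[1+5s,n]⇒5^j∣n s zero    n _ = 1∣ n
5^j∣geomSum[1+5s,n]⇒5^j∣n s (suc j) n 5^[1+j]∣S with 5∣n
  where
  5∣n : 5 ∣ n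
  5∣n = subst (5 ∣_) (geomSum[1,n] n) (∣geomSum[r+q*s]⇒∣geomSum[r] 1 s n (∣-trans (m∣m*n (5 ^ j)) 5^[1+j]∣S))
... | divides n′ refl = subst (5 ^ suc j ∣_) (*-comm 5 n′) (*-monoʳ-∣ 5 5^j∣n′)
  where
  x = proj₁ (geomSum[1+5s,n*5] s n′)
  5^j∣n′ : 5 ^ j ∣ n′
  5^j∣n′ = 5^j∣geomSum[1+5s,n]⇒5^j∣n s j n′
    (prime^∣a*b⇒prime^∣a j _ (1 + 5 * x) prime5 (5∤1+5x x)
      (*-cancelˡ-∣ 5 (subst (5 ^ suc j ∣_) (proj₂ (geomSum[1+5s,n*5] s n′)) 5^[1+j]∣S)))

∣geomSum[k+n]⇒∣geomSum[n] : ∀ {q r} k n → Prime q → ¬ q ∣ r → q ∣ geomSum r k → q ∣ geomSum r (k + n) → q ∣ geomSum r n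
∣geomSum[k+n]⇒∣geomSum[n] {q} {r} k n prq q∤r q∣S[k] q∣S[k+n] with euclidsLemma (r ^ k) (geomSum r n) prq q∣r^k*S[n]
  where
  q∣r^k*S[n] : q ∣ r ^ k * geomSum r n
  q∣r^k*S[n] = ∣m+n∣m⇒∣n (subst (q ∣_) (geomSum-+ r k n) q∣S[k+n]) q∣S[k]
... | inj₁ q∣r^k = contradiction q∣r^k (prime∤^ k prq q∤r)
... | inj₂ q∣S[n] = q∣S[n]

prime∤geomSum[r,1+2f] : ∀ {q} r → Prime q → ¬ q ∣ r → q ∣ geomSum r 4 → ¬ q ∣ geomSum r 3 → ∀ f → ¬ q ∣ geomSum r (1 + 2 * f)
prime∤geomSum[r,1+2f] {q} r prq q∤r q∣S[4] q∤S[3] zero = prime∤1 prq ∘ subst (q ∣_) (cong suc (*-zeroʳ r))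
prime∤geomSum[r,1+2f] r prq q∤r q∣S[4] q∤S[3] (suc zero) = q∤S[3]
prime∤geomSum[r,1+2f] {q} r prq q∤r q∣S[4] q∤S[3] (suc (suc f)) q∣S =
  prime∤geomSum[r,1+2f] r prq q∤r q∣S[4] q∤S[3] f
    (∣geomSum[k+n]⇒∣geomSum[n] 4 (1 + 2 * f) prq q∤r q∣S[4] (subst (λ n → q ∣ geomSum r n) (shift f) q∣S))
  where
  shift : ∀ f → 1 + 2 * (2 + f) ≡ 4 + (1 + 2 * f)
  shift = solve-∀

m≡m%q+q*[m/q] : ∀ m q .{{_ : NonZero q}} → m ≡ m % q + q * (m / q)
m≡m%q+q*[m/q] m q = trans (m≡m%n+[m/n]*n m q) (cong (m % q +_) (*-comm (m / q) q))

∣geomSum⇒∣geomSum[%] : ∀ {q} p n .{{_ : NonZero q}} → q ∣ geomSum p n → q ∣ geomSum (p % q) n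
∣geomSum⇒∣geomSum[%] {q} p n q∣S =
  ∣geomSum[r+q*s]⇒∣geomSum[r] (p % q) (p / q) n (subst (λ p → q ∣ geomSum p n) (m≡m%q+q*[m/q] p q) q∣S)

5∤geomSum[r,1+2f] : ∀ r {_ : False (5 ∣? r)} {_ : True (5 ∣? geomSum r 4)} {_ : False (5 ∣? geomSum r 3)} →
                    ∀ f → ¬ 5 ∣ geomSum r (1 + 2 * f)
5∤geomSum[r,1+2f] r {5∤r} {5∣S₄} {5∤S₃} =
  prime∤geomSum[r,1+2f] r prime5 (toWitnessFalse 5∤r) (toWitness 5∣S₄) (toWitnessFalse 5∤S₃)

5∣geomSum[p,1+2f]⇒p%5≡1 : ∀ {p} f → ¬ 5 ∣ p → 5 ∣ geomSum p (1 + 2 * f) → p % 5 ≡ 1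
5∣geomSum[p,1+2f]⇒p%5≡1 {p} f 5∤p 5∣S with p % 5 in p%5≡r | m%n<n p 5 | ∣geomSum⇒∣geomSum[%] p (1 + 2 * f) 5∣S
... | 0 | _ | _   = contradiction (m%n≡0⇒n∣m p 5 p%5≡r) 5∤p
... | 1 | _ | _   = refl
... | 2 | _ | 5∣S₂ = contradiction 5∣S₂ (5∤geomSum[r,1+2f] 2 f)
... | 3 | _ | 5∣S₃ = contradiction 5∣S₃ (5∤geomSum[r,1+2f] 3 f)
... | 4 | _ | 5∣S₄ = contradiction 5∣S₄ (5∤geomSum[r,1+2f] 4 f)
... | suc (suc (suc (suc (suc _)))) | s≤s (s≤s (s≤s (s≤s (s≤s ())))) | _

5^j∣geomSum[p,1+2f]⇒5^j∣1+2f : ∀ {p} j f → ¬ 5 ∣ p → 5 ^ j ∣ geomSum p (1 + 2 * f) → 5 ^ j ∣ 1 + 2 * f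
5^j∣geomSum[p,1+2f]⇒5^j∣1+2f     zero    f 5∤p _ = 1∣ _
5^j∣geomSum[p,1+2f]⇒5^j∣1+2f {p} (suc j) f 5∤p 5^j∣S =
  5^j∣geomSum[1+5s,n]⇒5^j∣n (p / 5) (suc j) (1 + 2 * f) (subst (λ p → 5 ^ suc j ∣ geomSum p (1 + 2 * f)) p≡1+5s 5^j∣S)
  where
  p≡1+5s : p ≡ 1 + 5 * (p / 5)
  p≡1+5s = trans (m≡m%q+q*[m/q] p 5) (cong (_+ 5 * (p / 5)) (5∣geomSum[p,1+2f]⇒p%5≡1 f 5∤p (∣-trans (m∣m*n (5 ^ j)) 5^j∣S)))

bernoulli : ∀ m n → 1 + n * m ≤ (1 + m) ^ n
bernoulli m zero    = ≤-refl
bernoulli m (suc n) = begin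
  1 + (m + n * m)                 ≡⟨ rearrange m n ⟩
  (1 + n * m) + m * 1             ≤⟨ +-monoʳ-≤ (1 + n * m) (*-monoʳ-≤ m (s≤s z≤n)) ⟩
  (1 + n * m) + m * (1 + n * m)   ≤⟨ *-monoʳ-≤ (1 + m) (bernoulli m n) ⟩
  (1 + m) * (1 + m) ^ n           ∎
  where
  open ≤-Reasoning
  rearrange : ∀ m n → 1 + (m + n * m) ≡ (1 + n * m) + m * 1
  rearrange = solve-∀

5^j∣1+2f⇒j<f : ∀ j f → 0 < f → 5 ^ j ∣ 1 + 2 * f → j < f
5^j∣1+2f⇒j<f zero    f 0<f _ = 0<f
5^j∣1+2f⇒j<f (suc j) f _ 5^[1+j]∣1+2f = <-≤-trans (m<m+n (suc j) z<s) (*-cancelˡ-≤ 2 4[1+j]≤2f)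
  where
  4[1+j]≤2f : 2 * (2 * suc j) ≤ 2 * f
  4[1+j]≤2f = ≤-pred (begin
    1 + 2 * (2 * suc j) ≡⟨ cong suc (double-double (suc j)) ⟩
    1 + suc j * 4       ≤⟨ bernoulli 4 (suc j) ⟩
    5 ^ suc j           ≤⟨ ∣⇒≤ 5^[1+j]∣1+2f ⟩
    1 + 2 * f           ∎)
    where
    open ≤-Reasoning
    double-double : ∀ n → 2 * (2 * n) ≡ n * 4
    double-double = solve-∀

-- Ω ≥ 2ω + 2 v₅(σ) on squares prime to 5

∃prime∣ : ∀ k → 1 < k → ∃[ p ] (Prime p × p ∣ k)
∃prime∣ (suc zero) (s≤s ())
∃prime∣ k@(suc (suc _)) _ with factorise k
... | record { factors = [] ; isFactorisation = () }
... | record { factors = p ∷ ps ; isFactorisation = k≡p*Πps ; factorsPrime = prp ∷ _ } =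
  p , prp , divides (product ps) (trans k≡p*Πps (*-comm p (product ps)))

p-free-part : ∀ {p} k → 1 < p → 0 < k → ∃[ f ] ∃[ u ] (k ≡ p ^ f * u × ¬ p ∣ u)
p-free-part {p} k 1<p 0<k = go k 0<k (<-wellFounded k)
  where
  go : ∀ k → 0 < k → Acc _<_ k → ∃[ f ] ∃[ u ] (k ≡ p ^ f * u × ¬ p ∣ u)
  go k 0<k (acc rec) with p ∣? k
  ... | no p∤k = 0 , k , sym (*-identityˡ k) , p∤k
  ... | yes (divides k′ refl) with go k′ 0<k′ (rec (m<m*n k′ p {{>-nonZero 0<k′}} 1<p))
    where
    0<k′ : 0 < k′
    0<k′ = >-nonZero⁻¹ k′ {{m*n≢0⇒m≢0 k′ {{>-nonZero 0<k}}}}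
  ... | f , u , refl , p∤u = suc f , u , p^f*u*p≡p*p^f*u , p∤u
    where
    p^f*u*p≡p*p^f*u : p ^ f * u * p ≡ p * p ^ f * u
    p^f*u*p≡p*p^f*u = trans (*-comm (p ^ f * u) p) (sym (*-assoc p (p ^ f) u))

Ω≥2ω+2v₅σ : ℕ → Set
Ω≥2ω+2v₅σ n = ∀ j → 5 ^ j ∣ σ n → 2 * ω n + 2 * j ≤ Ω n

Ω≥2ω+2v₅σ[1] : Ω≥2ω+2v₅σ 1
Ω≥2ω+2v₅σ[1] zero    _      = z≤n
Ω≥2ω+2v₅σ[1] (suc j) 5^j∣σ1 = contradiction (∣-trans (m∣m*n (5 ^ j)) 5^j∣σ1) (prime∤1 prime5)

Ω≥2ω+2v₅σ[p^2f*t] : ∀ {p t} f → Prime p → ¬ 5 ∣ p → ¬ p ∣ t → 0 < f →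
                    Ω≥2ω+2v₅σ t → Ω≥2ω+2v₅σ (p ^ (2 * f) * t)
Ω≥2ω+2v₅σ[p^2f*t] {p} {t} f pr 5∤p p∤t 0<f bound-t j 5^j∣σN
  with prime^-∣-*-split j (geomSum p (1 + 2 * f)) (σ t) prime5 (subst (5 ^ j ∣_) (σ[p^e*t] (2 * f) pr p∤t) 5^j∣σN)
... | i , l , refl , 5^i∣S , 5^l∣σt = begin
  2 * ω N + 2 * (i + l)               ≤⟨ +-monoˡ-≤ (2 * (i + l)) (*-monoʳ-≤ 2 (ω[p^e*t]≤1+ω[t] (2 * f) pr (∤⇒0< p∤t) 0<2f)) ⟩
  2 * (1 + ω t) + 2 * (i + l)         ≡⟨ regroup (ω t) i l ⟩
  2 * (1 + i) + (2 * ω t + 2 * l)     ≤⟨ +-mono-≤ (*-monoʳ-≤ 2 i<f) (bound-t l 5^l∣σt) ⟩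
  2 * f + Ω t                         ≤⟨ e+Ω[t]≤Ω[p^e*t] (2 * f) pr p∤t 0<2f ⟩
  Ω N                                 ∎
  where
  open ≤-Reasoning
  N = p ^ (2 * f) * t
  0<2f : 0 < 2 * f
  0<2f = *-monoʳ-< 2 0<f
  i<f : i < f
  i<f = 5^j∣1+2f⇒j<f i f 0<f (5^j∣geomSum[p,1+2f]⇒5^j∣1+2f i f 5∤p 5^i∣S)
  regroup : ∀ w i l → 2 * (1 + w) + 2 * (i + l) ≡ 2 * (1 + i) + (2 * w + 2 * l)
  regroup = solve-∀

[m^f*u]²≡m^[2f]*u² : ∀ m f u → (m ^ f * u) * (m ^ f * u) ≡ m ^ (2 * f) * (u * u)
[m^f*u]²≡m^[2f]*u² m f u = begin
  (m ^ f * u) * (m ^ f * u)   ≡⟨ *-interchange (m ^ f) u (m ^ f) u ⟩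
  (m ^ f * m ^ f) * (u * u)   ≡⟨ cong (_* (u * u)) (^-distribˡ-+-* m f f) ⟨
  m ^ (f + f) * (u * u)       ≡⟨ cong (λ e → m ^ (f + e) * (u * u)) (+-identityʳ f) ⟨
  m ^ (2 * f) * (u * u)       ∎
  where open ≡-Reasoning

p^b*[p^c*u]²≡p^[b+2c]*u² : ∀ p b c u → p ^ b * ((p ^ c * u) * (p ^ c * u)) ≡ p ^ (b + 2 * c) * (u * u)
p^b*[p^c*u]²≡p^[b+2c]*u² p b c u = begin
  p ^ b * ((p ^ c * u) * (p ^ c * u)) ≡⟨ cong (p ^ b *_) ([m^f*u]²≡m^[2f]*u² p c u) ⟩
  p ^ b * (p ^ (2 * c) * (u * u))     ≡⟨ *-assoc (p ^ b) _ _ ⟨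
  p ^ b * p ^ (2 * c) * (u * u)       ≡⟨ cong (_* (u * u)) (^-distribˡ-+-* p b (2 * c)) ⟨
  p ^ (b + 2 * c) * (u * u)           ∎
  where open ≡-Reasoning

prime∤u⇒prime∤u*u : ∀ {p u} → Prime p → ¬ p ∣ u → ¬ p ∣ u * u
prime∤u⇒prime∤u*u {u = u} pr p∤u p∣u*u with euclidsLemma u u pr p∣u*u
... | inj₁ p∣u = p∤u p∣u
... | inj₂ p∣u = p∤u p∣u

Ω≥2ω+2v₅σ[k*k] : ∀ k → ¬ 5 ∣ k → Ω≥2ω+2v₅σ (k * k)
Ω≥2ω+2v₅σ[k*k] k 5∤k = go k 5∤k (<-wellFounded k)
  where
  go : ∀ k → ¬ 5 ∣ k → Acc _<_ k → Ω≥2ω+2v₅σ (k * k)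
  go zero       5∤0 _ = contradiction (5 ∣0) 5∤0
  go (suc zero) _   _ = Ω≥2ω+2v₅σ[1]
  go k@(suc (suc _)) 5∤k (acc rec) with ∃prime∣ k (s≤s (s≤s z≤n))
  ... | p , pr , p∣k with p-free-part k (prime⇒1<p pr) z<s
  ... | zero , u , k≡1*u , p∤u = contradiction (subst (p ∣_) (trans k≡1*u (*-identityˡ u)) p∣k) p∤u
  ... | f@(suc _) , u , k≡p^f*u , p∤u =
    subst Ω≥2ω+2v₅σ k²≡p^2f*u²
      (Ω≥2ω+2v₅σ[p^2f*t] f pr (λ 5∣p → 5∤k (∣-trans 5∣p p∣k)) p∤u*u z<s
        (go u (λ 5∣u → 5∤k (∣-trans 5∣u u∣k)) (rec u<k)))
    where
    p∤u*u : ¬ p ∣ u * u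
    p∤u*u = prime∤u⇒prime∤u*u pr p∤u
    u∣k : u ∣ k
    u∣k = divides (p ^ f) k≡p^f*u
    u<k : u < k
    u<k = begin-strict
      u         <⟨ m<m*n u (p ^ f) {{>-nonZero (∤⇒0< p∤u)}} (^-monoʳ-< p (prime⇒1<p pr) {0} {f} z<s) ⟩
      u * p ^ f ≡⟨ *-comm u (p ^ f) ⟩
      p ^ f * u ≡⟨ k≡p^f*u ⟨
      k         ∎
      where open ≤-Reasoning
    k²≡p^2f*u² : p ^ (2 * f) * (u * u) ≡ k * k
    k²≡p^2f*u² = sym (trans (cong (λ k → k * k) k≡p^f*u) ([m^f*u]²≡m^[2f]*u² p f u))

friend⇒5^e∣σt : ∀ e t → 5 * σ (5 ^ suc e * t) ≡ 9 * (5 ^ suc e * t) → ¬ 5 ∣ t → 5 ^ e ∣ σ t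
friend⇒5^e∣σt e t friend 5∤t =
  -- geomSum 5 (2 + e) unfolds to 1 + 5 * geomSum 5 (1 + e).
  prime^∣a*b⇒prime^∣a e (σ t) (geomSum 5 (2 + e)) prime5 (5∤1+5x (geomSum 5 (1 + e)))
    (subst (5 ^ e ∣_) (trans (σ[p^e*t] (suc e) prime5 5∤t) (*-comm (geomSum 5 (2 + e)) (σ t))) 5^e∣σN)
  where
  5^e∣σN : 5 ^ e ∣ σ (5 ^ suc e * t)
  5^e∣σN = *-cancelˡ-∣ 5 (subst (5 ^ suc e ∣_) (sym friend) (∣-trans (m∣m*n t) (n∣m*n 9)))

2ω+3e≤Ω+4 : ∀ e u → 0 < e → ¬ 5 ∣ u → 5 * σ (5 ^ e * (u * u)) ≡ 9 * (5 ^ e * (u * u)) →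
            2 * ω (5 ^ e * (u * u)) + 3 * e ≤ Ω (5 ^ e * (u * u)) + 4
2ω+3e≤Ω+4 (suc e) u 0<e 5∤u friend = begin
  2 * ω N + 3 * suc e                   ≤⟨ +-monoˡ-≤ (3 * suc e) (*-monoʳ-≤ 2 (ω[p^e*t]≤1+ω[t] (suc e) prime5 0<u² 0<e)) ⟩
  2 * (1 + ω (u * u)) + 3 * suc e       ≡⟨ regroup (ω (u * u)) e ⟩
  suc e + (2 * ω (u * u) + 2 * e) + 4   ≤⟨ +-monoˡ-≤ 4 (+-monoʳ-≤ (suc e) (Ω≥2ω+2v₅σ[k*k] u 5∤u e 5^e∣σu²)) ⟩
  suc e + Ω (u * u) + 4                 ≤⟨ +-monoˡ-≤ 4 (e+Ω[t]≤Ω[p^e*t] (suc e) prime5 5∤u² 0<e) ⟩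
  Ω N + 4                               ∎
  where
  open ≤-Reasoning
  N = 5 ^ suc e * (u * u)
  5∤u² : ¬ 5 ∣ u * u
  5∤u² = prime∤u⇒prime∤u*u prime5 5∤u
  0<u² : 0 < u * u
  0<u² = ∤⇒0< 5∤u²
  5^e∣σu² : 5 ^ e ∣ σ (u * u)
  5^e∣σu² = friend⇒5^e∣σt e (u * u) friend 5∤u²
  regroup : ∀ w e → 2 * (1 + w) + 3 * suc e ≡ suc e + (2 * w + 2 * e) + 4
  regroup = solve-∀

theorem1p10 : (a m : ℕ) → .{{_ : NonZero a}} → .{{_ : NonZero m}} →
    FriendOf10 (5 ^ (2 * a) * (m * m)) →
    2 * ω (5 ^ (2 * a) * (m * m)) + 6 * a ≤ Ω (5 ^ (2 * a) * (m * m)) + 4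
theorem1p10 a m (_ , friend) with p-free-part m (prime⇒1<p prime5) (>-nonZero⁻¹ m)
... | c , u , m≡5^c*u , 5∤u = subst (λ N → 2 * ω N + 6 * a ≤ Ω N + 4) (sym N≡5^e*u²) (begin
  2 * ω N′ + 6 * a    ≤⟨ +-monoʳ-≤ (2 * ω N′) 6a≤3e ⟩
  2 * ω N′ + 3 * e    ≤⟨ 2ω+3e≤Ω+4 e u 0<e 5∤u (subst (λ N → 5 * σ N ≡ 9 * N) N≡5^e*u² friend) ⟩
  Ω N′ + 4            ∎)
  where
  open ≤-Reasoning
  e = 2 * a + 2 * c
  N′ = 5 ^ e * (u * u)
  0<e : 0 < e
  0<e = <-≤-trans (*-monoʳ-< 2 (>-nonZero⁻¹ a)) (m≤m+n (2 * a) (2 * c))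
  6a≤3e : 6 * a ≤ 3 * e
  6a≤3e = ≤-trans (≤-reflexive (*-assoc 3 2 a)) (*-monoʳ-≤ 3 (m≤m+n (2 * a) (2 * c)))
  N≡5^e*u² : 5 ^ (2 * a) * (m * m) ≡ N′
  N≡5^e*u² = trans (cong (λ m → 5 ^ (2 * a) * (m * m)) m≡5^c*u) (p^b*[p^c*u]²≡p^[b+2c]*u² 5 (2 * a) c u)
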